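{- Let $k\ge 2$ and suppose that $P$ and $Q$ are two different paths of length $k$ in a graph with the same two endpoints. If $P\cup Q$ is $\mathcal{C}_k$-free, then $P=\alpha P'\beta$ and $Q=\alpha Q'\beta$ for some pairwise vertex-disjoint paths $\alpha,\beta,P',Q'$.
   Context: Graphs are finite and simple. The length of a path is its number of edges. $\mathcal{C}_k=\{C_3,C_4,\dots,C_k\}$ is the family of cycles of length at most $k$; a graph is $\mathcal{C}_k$-free if it contains no cycle of length at most $k$. Juxtaposition of paths, e.g. $\alpha P'\beta$, denotes concatenation: the path traversing $\alpha$, then $P'$, then $\beta$, with consecutive pieces joined by an edge from the last vertex of one piece to the first vertex of the next. -}

module Defs where

open import Data.Nat using (ℕ; suc; _≤_)
open import Data.Fin using (Fin)
open import Data.List using (List; []; _∷_; _++_; [_]; length)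
open import Data.List.Relation.Unary.Linked using (Linked)
open import Data.List.Relation.Unary.Unique.Propositional using (Unique)
open import Data.Product using (Σ; ∃; _×_)
open import Data.Sum using (_⊎_)
open import Data.Empty using (⊥)
open import Relation.Nullary using (¬_)
open import Relation.Binary.PropositionalEquality using (_≡_; _≢_)

record Graph (n : ℕ) : Set₁ where
  field
    Adj    : Fin n → Fin n → Set
    sym    : ∀ {u v} → Adj u v → Adj v u
    irrefl : ∀ {u} → ¬ Adj u u
open Graph public

IsPath : ∀ {n} → Graph n → List (Fin n) → Set
IsPath G p = (p ≢ []) × Linked (Adj G) p × Unique p

-- A path with k+1 vertices has length (number of edges) k.
HasLength : ∀ {A : Set} → List A → ℕ → Set
HasLength p k = length p ≡ suc k

PathEdge : ∀ {A : Set} → List A → A → A → Set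
PathEdge {A} p a b =
  (Σ (List A) λ xs → Σ (List A) λ ys → p ≡ xs ++ (a ∷ b ∷ ys)) ⊎
  (Σ (List A) λ xs → Σ (List A) λ ys → p ≡ xs ++ (b ∷ a ∷ ys))

UnionEdge : ∀ {A : Set} → List A → List A → A → A → Set
UnionEdge p q a b = PathEdge p a b ⊎ PathEdge q a b

IsCycle : ∀ {A : Set} → (A → A → Set) → List A → Set
IsCycle {A} E c =
  Σ A λ x → Σ (List A) λ rest →
    (c ≡ x ∷ rest) × Linked E (c ++ [ x ]) × Unique c × (3 ≤ length c)

CkFree : ∀ {A : Set} → (A → A → Set) → ℕ → Set
CkFree {A} E k = ∀ (c : List A) → IsCycle E c → length c ≤ k → ⊥

-- Let x be the vertex at which P and Q part, and w the first vertex of P after x that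
-- lies on Q after x.  The branches of P and Q from x to w are internally disjoint, so they
-- form a cycle whose length is the sum of their lengths; hence that sum exceeds k.  If the
-- tails of P and Q after w still differed, they would contain a second cycle, no longer
-- than the two tails together.  Since P and Q have total length 2k, the tails together
-- are shorter than k, contradicting C_k-freeness.  So the tails coincide, the branches
-- have equal (hence positive) length, and α = P up to x, β = P from w on.
module Submission where

open import Defs hiding (sym)
open import Data.Nat using (ℕ; suc; _+_; _≤_; _<_; s≤s; s≤s⁻¹; z≤n)
open import Data.Nat.Properties
  using (≤-trans; ≤-reflexive; <⇒≤; ≰⇒>; m≤m+n; m≤n+m; +-mono-≤; +-monoˡ-≤; +-suc;
         +-cancelˡ-≤; +-cancelˡ-≡; +-cancelʳ-≡; suc-injective; module ≤-Reasoning)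
open import Data.Nat.Tactic.RingSolver using (solve-∀)
open import Data.Fin using (Fin; _≟_)
open import Data.List using (List; []; _∷_; _++_; [_]; _ʳ++_; head; last; length)
open import Data.List.Properties using (++-assoc; ++-ʳ++; length-++; length-ʳ++; ++-conicalˡ; ++-conicalʳ; ≡-dec)
open import Data.List.Relation.Unary.All as All using (All; []; _∷_)
open import Data.List.Relation.Unary.All.Properties using (++⁻ˡ; ++⁻ʳ)
open import Data.List.Relation.Unary.AllPairs using ([]; _∷_)
open import Data.List.Relation.Unary.Any using (here; there)
import Data.List.Relation.Unary.First as First
open import Data.List.Relation.Unary.First.Properties using (toView)
open import Data.List.Relation.Unary.Linked as Linked using (Linked; []; [-]; _∷_)
open import Data.List.Relation.Unary.Unique.Propositional using (Unique)
open import Data.List.Relation.Unary.Unique.Propositional.Properties using (Unique[x∷xs]⇒x∉xs)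
open import Data.List.Membership.Propositional using (_∈_; _∉_)
open import Data.List.Membership.Propositional.Properties using (∈-++⁺ˡ; ∈-++⁺ʳ; ∈-++⁻; ∈-∃++)
open import Data.List.Relation.Binary.Disjoint.Propositional using (Disjoint)
import Data.List.Relation.Binary.Disjoint.Propositional.Properties as Disjoint
open import Data.Maybe using (just)
open import Data.Product using (Σ; _×_; _,_; proj₁; proj₂)
open import Data.Sum using (inj₁; inj₂)
import Data.Sum as Sum
open import Function using (_∘_; flip)
open import Relation.Binary.Definitions using (DecidableEquality)
open import Relation.Nullary using (yes; no; contradiction)
open import Relation.Nullary.Decidable using (toSum; decidable-stable)
open import Relation.Binary.PropositionalEquality
  using (_≡_; _≢_; refl; sym; trans; cong; cong₂; subst; subst₂; module ≡-Reasoning)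

module _ {A : Set} where

  Linked-++⁻ : ∀ {R : A → A → Set} xs {ys} → Linked R (xs ++ ys) → Linked R xs × Linked R ys
  Linked-++⁻ []           l       = [] , l
  Linked-++⁻ (x ∷ [])     l       = [-] , Linked.tail l
  Linked-++⁻ (x ∷ y ∷ xs) (r ∷ l) with Linked-++⁻ (y ∷ xs) l
  ... | l₁ , l₂ = r ∷ l₁ , l₂

  Linked-ʳ++ : ∀ {R : A → A → Set} {x} xs {ys} →
    Linked R (x ∷ xs) → Linked (flip R) (x ∷ ys) → Linked (flip R) (xs ʳ++ x ∷ ys)
  Linked-ʳ++ []       _       l = l
  Linked-ʳ++ (y ∷ xs) (r ∷ rs) l = Linked-ʳ++ xs rs (r ∷ l)

  Unique-++⁻ : ∀ xs {ys : List A} → Unique (xs ++ ys) → Unique xs × Unique ys × Disjoint xs ys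
  Unique-++⁻ []       ys!             = [] , ys! , λ ()
  Unique-++⁻ (x ∷ xs) (x∉xsys ∷ xsys!) with Unique-++⁻ xs xsys!
  ... | xs! , ys! , xs#ys = ++⁻ˡ xs x∉xsys ∷ xs! , ys! , disjoint
    where
    disjoint : Disjoint (x ∷ xs) _
    disjoint (here refl , v∈ys) = All.lookup (++⁻ʳ xs x∉xsys) v∈ys refl
    disjoint (there v∈xs , v∈ys) = xs#ys (v∈xs , v∈ys)

  Unique-++⁻ʳ : ∀ xs {ys : List A} → Unique (xs ++ ys) → Unique ys
  Unique-++⁻ʳ xs = proj₁ ∘ proj₂ ∘ Unique-++⁻ xs

  Unique-ʳ++ : ∀ {xs ys : List A} → Unique xs → Unique ys → Disjoint xs ys → Unique (xs ʳ++ ys)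
  Unique-ʳ++ {[]}     _             ys! _     = ys!
  Unique-ʳ++ {x ∷ xs} (x∉xs ∷ xs!) ys! xs#ys = Unique-ʳ++ xs! (x∉ys ∷ ys!) xs#xys
    where
    x∉ys : All (x ≢_) _
    x∉ys = All.tabulate λ y∈ys x≡y → xs#ys (here (sym x≡y) , y∈ys)
    xs#xys : Disjoint xs (x ∷ _)
    xs#xys (v∈xs , here refl)   = All.lookup x∉xs v∈xs refl
    xs#xys (v∈xs , there v∈ys) = xs#ys (there v∈xs , v∈ys)

  Disjoint-++⁻ : ∀ {xs} ys {zs : List A} → Disjoint xs (ys ++ zs) → Disjoint xs ys × Disjoint xs zs
  Disjoint-++⁻ ys xs#yszs =
    (λ (v∈xs , v∈ys) → xs#yszs (v∈xs , ∈-++⁺ˡ v∈ys)) ,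
    (λ (v∈xs , v∈zs) → xs#yszs (v∈xs , ∈-++⁺ʳ ys v∈zs))

  last-∈ : ∀ xs {v : A} → last xs ≡ just v → v ∈ xs
  last-∈ (x ∷ [])     refl = here refl
  last-∈ (x ∷ y ∷ xs) eq   = there (last-∈ (y ∷ xs) eq)

  last-∷ : ∀ (x : A) xs → Σ A λ v → last (x ∷ xs) ≡ just v
  last-∷ x []       = x , refl
  last-∷ x (y ∷ xs) = last-∷ y xs

  last-++ : ∀ xs {y : A} ys → last (xs ++ y ∷ ys) ≡ last (y ∷ ys)
  last-++ []           ys = refl
  last-++ (x ∷ [])     ys = refl
  last-++ (x ∷ x′ ∷ xs) ys = last-++ (x′ ∷ xs) ys

  ʳ++-++ : ∀ (xs : List A) {ys zs} → (xs ʳ++ ys) ++ zs ≡ xs ʳ++ (ys ++ zs)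
  ʳ++-++ []       = refl
  ʳ++-++ (x ∷ xs) = ʳ++-++ xs

  PathEdge-sym : ∀ {p : List A} {a b} → PathEdge p a b → PathEdge p b a
  PathEdge-sym = Sum.swap

  PathEdge-++⁺ʳ : ∀ xs {p : List A} {a b} → PathEdge p a b → PathEdge (xs ++ p) a b
  PathEdge-++⁺ʳ xs (inj₁ (us , vs , refl)) = inj₁ (xs ++ us , vs , sym (++-assoc xs us _))
  PathEdge-++⁺ʳ xs (inj₂ (us , vs , refl)) = inj₂ (xs ++ us , vs , sym (++-assoc xs us _))

  PathEdge-infix : ∀ (xs ys zs : List A) → Linked (PathEdge (xs ++ ys ++ zs)) ys
  PathEdge-infix xs []            zs = []
  PathEdge-infix xs (y ∷ [])      zs = [-]
  PathEdge-infix xs (y ∷ y′ ∷ ys) zs =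
    inj₁ (xs , ys ++ zs , refl) ∷
    subst (λ p → Linked (PathEdge p) (y′ ∷ ys)) (++-assoc xs [ y ] _) (PathEdge-infix (xs ++ [ y ]) (y′ ∷ ys) zs)

  UnionEdge-sym : ∀ {P Q : List A} {a b} → UnionEdge P Q a b → UnionEdge P Q b a
  UnionEdge-sym = Sum.map PathEdge-sym PathEdge-sym

  UnionEdge-++⁺ʳ : ∀ xs ys {P Q : List A} {a b} → UnionEdge P Q a b → UnionEdge (xs ++ P) (ys ++ Q) a b
  UnionEdge-++⁺ʳ xs ys = Sum.map (PathEdge-++⁺ʳ xs) (PathEdge-++⁺ʳ ys)

  IsCycle-mono : ∀ {E F : A → A → Set} {c} → (∀ {a b} → E a b → F a b) → IsCycle E c → IsCycle F c
  IsCycle-mono E⇒F (x , rest , c≡ , closed , c! , 3≤c) = x , rest , c≡ , Linked.map E⇒F closed , c! , 3≤c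

  record Fork (P Q : List A) : Set where
    constructor fork
    field
      α P₁ Q₁ P₂ Q₂ : List A
      x w : A
      P≡ : P ≡ α ++ x ∷ P₁ ++ w ∷ P₂
      Q≡ : Q ≡ α ++ x ∷ Q₁ ++ w ∷ Q₂
      branches-disjoint : Disjoint P₁ Q₁
      branches-nontrivial : 0 < length P₁ + length Q₁

  fork-∷ : ∀ y {P Q} → Fork P Q → Fork (y ∷ P) (y ∷ Q)
  fork-∷ y (fork α P₁ Q₁ P₂ Q₂ x w P≡ Q≡ P₁#Q₁ P₁Q₁≢[]) =
    fork (y ∷ α) P₁ Q₁ P₂ Q₂ x w (cong (y ∷_) P≡) (cong (y ∷_) Q≡) P₁#Q₁ P₁Q₁≢[]

  length-fork : ∀ α (x : A) B w T → length (α ++ x ∷ B ++ w ∷ T) ≡ length α + suc (length B + suc (length T))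
  length-fork α x B w T = trans (length-++ α) (cong (λ n → length α + suc n) (length-++ B))

  branch-edges : ∀ α (x : A) B w T → Linked (PathEdge (α ++ x ∷ B ++ w ∷ T)) (x ∷ B ++ [ w ])
  branch-edges α x B w T = subst (λ p → Linked (PathEdge p) (x ∷ B ++ [ w ]))
    (cong (λ t → α ++ x ∷ t) (++-assoc B [ w ] T)) (PathEdge-infix α (x ∷ B ++ [ w ]) T)

  branch-unique : ∀ α (x : A) B w T → Unique (α ++ x ∷ B ++ w ∷ T) → Unique (x ∷ B ++ [ w ])
  branch-unique α x B w T p! = proj₁ (Unique-++⁻ (x ∷ B ++ [ w ])
    (subst Unique (cong (λ t → x ∷ t) (sym (++-assoc B [ w ] T))) (Unique-++⁻ʳ α p!)))

  -- The cycle runs from w back along Q₁ to x and then along P₁ to w.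
  fork-cycle : ∀ {P Q} (f : Fork P Q) → Unique P → Unique Q →
    Σ (List A) λ c → IsCycle (UnionEdge P Q) c ×
      length c + (length (Fork.w f ∷ Fork.P₂ f) + length (Fork.w f ∷ Fork.Q₂ f)) ≤ length P + length Q
  fork-cycle (fork α P₁ Q₁ P₂ Q₂ x w refl refl P₁#Q₁ nontrivial) P! Q! =
    c , (w , Q₁ ʳ++ x ∷ P₁ , ++-ʳ++ Q₁ , closed , c! , 3≤c) , fits
    where
    P Q c : List A
    P = α ++ x ∷ P₁ ++ w ∷ P₂
    Q = α ++ x ∷ Q₁ ++ w ∷ Q₂
    c = (Q₁ ++ [ w ]) ʳ++ x ∷ P₁

    closed : Linked (UnionEdge P Q) (c ++ [ w ])
    closed = subst (Linked (UnionEdge P Q)) (sym (ʳ++-++ (Q₁ ++ [ w ])))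
      (Linked.map UnionEdge-sym (Linked-ʳ++ (Q₁ ++ [ w ])
        (Linked.map inj₂ (branch-edges α x Q₁ w Q₂))
        (Linked.map (inj₁ ∘ PathEdge-sym) (branch-edges α x P₁ w P₂))))

    xP₁w! : Unique (x ∷ P₁) × Unique [ w ] × Disjoint (x ∷ P₁) [ w ]
    xP₁w! = Unique-++⁻ (x ∷ P₁) (branch-unique α x P₁ w P₂ P!)
    xQ₁w! : Unique (x ∷ Q₁ ++ [ w ])
    xQ₁w! = branch-unique α x Q₁ w Q₂ Q!

    Q₁w#xP₁ : Disjoint (Q₁ ++ [ w ]) (x ∷ P₁)
    Q₁w#xP₁ (v∈Q₁w , here refl) = Unique[x∷xs]⇒x∉xs xQ₁w! v∈Q₁w
    Q₁w#xP₁ (v∈Q₁w , there v∈P₁) with ∈-++⁻ Q₁ v∈Q₁w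
    ... | inj₁ v∈Q₁       = P₁#Q₁ (v∈P₁ , v∈Q₁)
    ... | inj₂ (here refl) = proj₂ (proj₂ xP₁w!) (there v∈P₁ , here refl)

    c! : Unique c
    c! = Unique-ʳ++ (Unique-++⁻ʳ [ x ] xQ₁w!) (proj₁ xP₁w!) Q₁w#xP₁

    length-c : length c ≡ 2 + (length P₁ + length Q₁)
    length-c = begin
      length c                                      ≡⟨ length-ʳ++ (Q₁ ++ [ w ]) ⟩
      length (Q₁ ++ [ w ]) + suc (length P₁)        ≡⟨ cong (_+ suc (length P₁)) (length-++ Q₁) ⟩
      length Q₁ + 1 + suc (length P₁)               ≡⟨ regroup (length P₁) (length Q₁) ⟩
      2 + (length P₁ + length Q₁)                   ∎
      where
      open ≡-Reasoning
      regroup : ∀ p q → q + 1 + suc p ≡ 2 + (p + q)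
      regroup = solve-∀

    3≤c : 3 ≤ length c
    3≤c = subst (3 ≤_) (sym length-c) (s≤s (s≤s nontrivial))

    fits : length c + (suc (length P₂) + suc (length Q₂)) ≤ length P + length Q
    fits = begin
      length c + (suc (length P₂) + suc (length Q₂))
        ≡⟨ cong (_+ _) length-c ⟩
      2 + (length P₁ + length Q₁) + (suc (length P₂) + suc (length Q₂))
        ≡⟨ regroup (length P₁) (length Q₁) (length P₂) (length Q₂) ⟩
      suc (length P₁ + suc (length P₂)) + suc (length Q₁ + suc (length Q₂))
        ≤⟨ +-mono-≤ (m≤n+m _ (length α)) (m≤n+m _ (length α)) ⟩
      (length α + suc (length P₁ + suc (length P₂))) + (length α + suc (length Q₁ + suc (length Q₂)))
        ≡⟨ sym (cong₂ _+_ (length-fork α x P₁ w P₂) (length-fork α x Q₁ w Q₂)) ⟩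
      length P + length Q ∎
      where
      open ≤-Reasoning
      regroup : ∀ p q s t → 2 + (p + q) + (suc s + suc t) ≡ suc (p + suc s) + suc (q + suc t)
      regroup = solve-∀

  first-steps-differ : ∀ {p q w : A} P₁ Q₁ {P P₂ Q Q₂} → p ≢ q →
    p ∷ P ≡ P₁ ++ w ∷ P₂ → q ∷ Q ≡ Q₁ ++ w ∷ Q₂ → 0 < length P₁ + length Q₁
  first-steps-differ []      []      p≢q refl refl = contradiction refl p≢q
  first-steps-differ []      (_ ∷ _) _   _    _    = s≤s z≤n
  first-steps-differ (_ ∷ _) _       _   _    _    = s≤s z≤n

  both-nonempty : ∀ (xs ys : List A) → length xs ≡ length ys → 0 < length xs + length ys → xs ≢ [] × ys ≢ []
  both-nonempty []      []      _  ()
  both-nonempty (_ ∷ _) (_ ∷ _) _  _ = (λ ()) , (λ ())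

module _ {A : Set} (_≟_ : DecidableEquality A) where

  open import Data.List.Membership.DecPropositional _≟_ using (_∈?_)

  first-meeting : ∀ {v : A} xs ys → v ∈ xs → v ∈ ys →
    Σ (List A) λ xs₁ → Σ A λ w → Σ (List A) λ xs₂ →
      (xs ≡ xs₁ ++ w ∷ xs₂) × Disjoint xs₁ ys × w ∈ ys
  first-meeting xs ys v∈xs v∈ys
    with First.first {P = _∉ ys} {Q = _∈ ys} (λ u → Sum.swap (toSum (u ∈? ys))) xs
  ... | inj₂ xs∉ys = contradiction v∈ys (All.lookup xs∉ys v∈xs)
  ... | inj₁ first with toView first
  ... | First._++_∷_ {xs₁} {w} xs₁∉ys w∈ys xs₂ =
    xs₁ , w , xs₂ , refl , (λ (u∈xs₁ , u∈ys) → All.lookup xs₁∉ys u∈xs₁ u∈ys) , w∈ys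

  fork-at : ∀ x {p q} P Q → p ≢ q → last (p ∷ P) ≡ last (q ∷ Q) → Fork (x ∷ p ∷ P) (x ∷ q ∷ Q)
  fork-at x {p} {q} P Q p≢q lasts =
    let v , last≡v = last-∷ p P
        P₁ , w , P₂ , pP≡ , P₁#qQ , w∈qQ =
          first-meeting (p ∷ P) (q ∷ Q) (last-∈ (p ∷ P) last≡v) (last-∈ (q ∷ Q) (trans (sym lasts) last≡v))
        Q₁ , Q₂ , qQ≡ = ∈-∃++ w∈qQ
    in fork [] P₁ Q₁ P₂ Q₂ x w (cong (x ∷_) pP≡) (cong (x ∷_) qQ≡)
         (λ (u∈P₁ , u∈Q₁) → P₁#qQ (u∈P₁ , subst (_ ∈_) (sym qQ≡) (∈-++⁺ˡ u∈Q₁)))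
         (first-steps-differ P₁ Q₁ p≢q pP≡ qQ≡)

  first-fork : ∀ x P Q → Unique (x ∷ P) → Unique (x ∷ Q) →
    last (x ∷ P) ≡ last (x ∷ Q) → P ≢ Q → Fork (x ∷ P) (x ∷ Q)
  first-fork x []      []      _  _  _     P≢Q = contradiction refl P≢Q
  first-fork x []      (q ∷ Q) _  Q! lasts _   = contradiction (last-∈ (q ∷ Q) (sym lasts)) (Unique[x∷xs]⇒x∉xs Q!)
  first-fork x (p ∷ P) []      P! _  lasts _   = contradiction (last-∈ (p ∷ P) lasts) (Unique[x∷xs]⇒x∉xs P!)
  first-fork x (p ∷ P) (q ∷ Q) P! Q! lasts P≢Q with p ≟ q
  ... | yes refl = fork-∷ x (first-fork p P Q (Unique-++⁻ʳ [ x ] P!) (Unique-++⁻ʳ [ x ] Q!) lasts (P≢Q ∘ cong (p ∷_)))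
  ... | no p≢q   = fork-at x P Q p≢q lasts

  short-cycle : ∀ x P Q → Unique (x ∷ P) → Unique (x ∷ Q) → last (x ∷ P) ≡ last (x ∷ Q) → P ≢ Q →
    Σ (List A) λ c → IsCycle (UnionEdge (x ∷ P) (x ∷ Q)) c × length c ≤ length P + length Q
  short-cycle x P Q P! Q! lasts P≢Q =
    let c , c-cycle , c-fits = fork-cycle (first-fork x P Q P! Q! lasts P≢Q) P! Q!
    in c , c-cycle , drop-tails c-fits
    where
    drop-tails : ∀ {c s t m n} → c + (suc s + suc t) ≤ suc m + suc n → c ≤ m + n
    drop-tails {c} {s} {t} {m} {n} fits =
      ≤-trans (m≤m+n c (s + t)) (s≤s⁻¹ (s≤s⁻¹ (subst₂ _≤_ (regroup c s t) (regroup′ m n) fits)))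
      where
      regroup : ∀ c s t → c + (suc s + suc t) ≡ 2 + (c + (s + t))
      regroup = solve-∀
      regroup′ : ∀ m n → suc m + suc n ≡ 2 + (m + n)
      regroup′ = solve-∀

  fork-tails-agree : ∀ {k} {P Q : List A} (f : Fork P Q) → Unique P → Unique Q → last P ≡ last Q →
    length P ≡ suc k → length Q ≡ suc k → CkFree (UnionEdge P Q) k → Fork.P₂ f ≡ Fork.Q₂ f
  fork-tails-agree {k} f@(fork α P₁ Q₁ P₂ Q₂ x w refl refl _ _) P! Q! lasts |P| |Q| free =
    decidable-stable (≡-dec _≟_ P₂ Q₂) λ P₂≢Q₂ →
      let c₁ , c₁-cycle , c₁-fits = fork-cycle f P! Q!
          c₂ , c₂-cycle , c₂-short = short-cycle w P₂ Q₂
            (Unique-++⁻ʳ (x ∷ P₁) (Unique-++⁻ʳ α P!)) (Unique-++⁻ʳ (x ∷ Q₁) (Unique-++⁻ʳ α Q!)) tails-last P₂≢Q₂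
          tails-short = tails-shorter-than-k {s = length P₂} {t = length Q₂}
            (≰⇒> (free c₁ c₁-cycle)) (≤-trans c₁-fits (≤-reflexive (cong₂ _+_ |P| |Q|)))
      in free c₂ (IsCycle-mono (λ e → UnionEdge-++⁺ʳ α α (UnionEdge-++⁺ʳ (x ∷ P₁) (x ∷ Q₁) e)) c₂-cycle)
           (≤-trans c₂-short (<⇒≤ tails-short))
    where
    tails-last : last (w ∷ P₂) ≡ last (w ∷ Q₂)
    tails-last = begin
      last (w ∷ P₂)                 ≡⟨ sym (last-++ (x ∷ P₁) P₂) ⟩
      last (x ∷ P₁ ++ w ∷ P₂)       ≡⟨ sym (last-++ α _) ⟩
      last (α ++ x ∷ P₁ ++ w ∷ P₂)  ≡⟨ lasts ⟩
      last (α ++ x ∷ Q₁ ++ w ∷ Q₂)  ≡⟨ last-++ α _ ⟩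
      last (x ∷ Q₁ ++ w ∷ Q₂)       ≡⟨ last-++ (x ∷ Q₁) Q₂ ⟩
      last (w ∷ Q₂)                 ∎
      where open ≡-Reasoning
    tails-shorter-than-k : ∀ {c s t} → k < c → c + (suc s + suc t) ≤ suc k + suc k → s + t < k
    tails-shorter-than-k {s = s} {t = t} k<c fits =
      subst (_≤ k) (+-suc s t)
        (s≤s⁻¹ (+-cancelˡ-≤ (suc k) _ _ (≤-trans (+-monoˡ-≤ _ k<c) fits)))

module _ {n : ℕ} (G : Graph n) where

  CommonEndsSplit : List (Fin n) → List (Fin n) → Set
  CommonEndsSplit P Q =
    Σ (List (Fin n)) λ α → Σ (List (Fin n)) λ β →
    Σ (List (Fin n)) λ P′ → Σ (List (Fin n)) λ Q′ →
      IsPath G α × IsPath G β × IsPath G P′ × IsPath G Q′ ×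
      (P ≡ α ++ P′ ++ β) × (Q ≡ α ++ Q′ ++ β) ×
      Disjoint α β × Disjoint α P′ × Disjoint α Q′ ×
      Disjoint β P′ × Disjoint β Q′ × Disjoint P′ Q′

  IsPath-++⁻ : ∀ xs {ys} → xs ≢ [] → ys ≢ [] → IsPath G (xs ++ ys) →
    IsPath G xs × IsPath G ys × Disjoint xs ys
  IsPath-++⁻ xs xs≢[] ys≢[] (_ , linked , unique) =
    let xs-linked , ys-linked = Linked-++⁻ xs linked
        xs! , ys! , xs#ys = Unique-++⁻ xs unique
    in (xs≢[] , xs-linked , xs!) , (ys≢[] , ys-linked , ys!) , xs#ys

  IsPath-++-++⁻ : ∀ xs ys {zs} → xs ≢ [] → ys ≢ [] → zs ≢ [] → IsPath G (xs ++ ys ++ zs) →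
    IsPath G xs × IsPath G ys × IsPath G zs × Disjoint xs ys × Disjoint xs zs × Disjoint ys zs
  IsPath-++-++⁻ xs ys xs≢[] ys≢[] zs≢[] path =
    let xs-path , yszs-path , xs#yszs = IsPath-++⁻ xs xs≢[] (ys≢[] ∘ ++-conicalˡ ys _) path
        ys-path , zs-path , ys#zs = IsPath-++⁻ ys ys≢[] zs≢[] yszs-path
        xs#ys , xs#zs = Disjoint-++⁻ ys xs#yszs
    in xs-path , ys-path , zs-path , xs#ys , xs#zs , ys#zs

  fork-split : ∀ {P Q} (f : Fork P Q) → Fork.P₂ f ≡ Fork.Q₂ f → length P ≡ length Q →
    IsPath G P → IsPath G Q → CommonEndsSplit P Q
  fork-split (fork α P₁ Q₁ P₂ Q₂ x w refl refl P₁#Q₁ nontrivial) refl |P|≡|Q| P-path Q-path =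
    let P₁≢[] , Q₁≢[] = both-nonempty P₁ Q₁ |P₁|≡|Q₁| nontrivial
        α-path , P₁-path , β-path , α#P₁ , α#β , P₁#β = IsPath-++-++⁻ (α ++ [ x ]) P₁ α≢[] P₁≢[] (λ ())
          (subst (IsPath G) (regroup P₁) P-path)
        _ , Q₁-path , _ , α#Q₁ , _ , Q₁#β = IsPath-++-++⁻ (α ++ [ x ]) Q₁ α≢[] Q₁≢[] (λ ())
          (subst (IsPath G) (regroup Q₁) Q-path)
    in α ++ [ x ] , w ∷ P₂ , P₁ , Q₁ , α-path , β-path , P₁-path , Q₁-path , regroup P₁ , regroup Q₁ ,
       α#β , α#P₁ , α#Q₁ , Disjoint.sym P₁#β , Disjoint.sym Q₁#β , P₁#Q₁
    where
    regroup : ∀ B → α ++ x ∷ B ++ w ∷ P₂ ≡ (α ++ [ x ]) ++ B ++ w ∷ P₂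
    regroup B = sym (++-assoc α [ x ] _)
    α≢[] : α ++ [ x ] ≢ []
    α≢[] = (λ ()) ∘ ++-conicalʳ α [ x ]
    |P₁|≡|Q₁| : length P₁ ≡ length Q₁
    |P₁|≡|Q₁| = +-cancelʳ-≡ (suc (length P₂)) (length P₁) (length Q₁) (suc-injective (+-cancelˡ-≡ (length α) _ _
      (trans (sym (length-fork α x P₁ w P₂)) (trans |P|≡|Q| (length-fork α x Q₁ w P₂)))))

lemma5p6 : ∀ {n : ℕ} (G : Graph n) (k : ℕ) → 2 ≤ k →
    (P Q : List (Fin n)) →
    IsPath G P → IsPath G Q → HasLength P k → HasLength Q k →
    head P ≡ head Q → last P ≡ last Q → P ≢ Q →
    CkFree (UnionEdge P Q) k →
    Σ (List (Fin n)) λ α → Σ (List (Fin n)) λ β →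
    Σ (List (Fin n)) λ P′ → Σ (List (Fin n)) λ Q′ →
    IsPath G α × IsPath G β × IsPath G P′ × IsPath G Q′ ×
    (P ≡ α ++ P′ ++ β) × (Q ≡ α ++ Q′ ++ β) ×
    Disjoint α β × Disjoint α P′ × Disjoint α Q′ ×
    Disjoint β P′ × Disjoint β Q′ × Disjoint P′ Q′
lemma5p6 G k _ []      _       ([]≢[] , _) _ _ _ _ _ _ _ = contradiction refl []≢[]
lemma5p6 G k _ (_ ∷ _) []      _ ([]≢[] , _) _ _ _ _ _ _ = contradiction refl []≢[]
lemma5p6 G k _ (x ∷ P) (_ ∷ Q) P-path Q-path |P| |Q| refl lasts P≢Q free =
  fork-split G f (fork-tails-agree _≟_ f P! Q! lasts |P| |Q| free) (trans |P| (sym |Q|)) P-path Q-path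
  where
  P! : Unique (x ∷ P)
  P! = proj₂ (proj₂ P-path)
  Q! : Unique (x ∷ Q)
  Q! = proj₂ (proj₂ Q-path)
  f : Fork (x ∷ P) (x ∷ Q)
  f = first-fork _≟_ x P Q P! Q! lasts (P≢Q ∘ cong (x ∷_))
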